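{- Any two parameters in $\{\mathrm{d\text{ - }nw},\mathrm{d\text{ - }lnlcw},\mathrm{d\text{ - }lcw}\}$ are linearly equivalent: for any two of them $\alpha,\beta$ there exist linear functions $f_1,f_2:\mathbb N\to\mathbb N$ such that for every digraph $G$, $\alpha(G)\le f_1(\beta(G))$ and $\beta(G)\le f_2(\alpha(G))$.
   Context: Digraphs $G=(V,E)$ are finite with $E\subseteq\{(u,v):u\ne v\}$. A layout is a bijection $\varphi:V\to\{1,\dots,|V|\}$; $L(i,\varphi)=\{u:\varphi(u)\le i\}$, $R(i,\varphi)=\{u:\varphi(u)>i\}$. With $N_i(u)=(\{v\in R(i,\varphi):(u,v)\in E\},\{v\in R(i,\varphi):(v,u)\in E\})$, $\mathrm{d\text{ - }nw}(G)=\min_\varphi\max_i|\{N_i(u):u\in L(i,\varphi)\}|$. $\mathrm{d\text{ - }lnlcw}(G)$ is the least $k$ such that $G$ (under some labeling) is built from labeled digraphs with labels in $[k]$ by: $\bullet_a$ (a vertex labeled $a$); $H\otimes_{(\overrightarrow S,\overleftarrow S)}\bullet_a$ ($\overrightarrow S,\overleftarrow S\subseteq[k]^2$): add a new vertex $v$ labeled $a$ plus arcs $(u,v)$ for $u$ in $H$ of label $b$ with $(b,a)\in\overrightarrow S$ and arcs $(v,u)$ for $u$ in $H$ of label $b$ with $(b,a)\in\overleftarrow S$; $\circ_R$ ($R:[k]\to[k]$, relabel $a$ to $R(a)$). $\mathrm{d\text{ - }lcw}(G)$ is the least number of labels to build $G$ with $\bullet_a$, $H\oplus\bullet_a$ (add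 a new isolated vertex labeled $a$), $\alpha_{a,b}$ ($a\ne b$; add arcs from all label-$a$ to all label-$b$ vertices), $\rho_{a\to b}$ (relabel). -}

module Defs where

open import Data.Bool using (Bool; true; false; _∧_; _∨_; not; if_then_else_)
open import Data.Nat using (ℕ; zero; suc; _+_; _*_; _≤_; _<ᵇ_; _⊔_)
open import Data.Fin using (Fin; zero; suc; toℕ)
open import Data.Fin.Properties using () renaming (_≟_ to _≟ᶠ_)
open import Data.Fin.Permutation using (Permutation; Permutation′; _⟨$⟩ʳ_)
open import Data.List using (List; allFin; map; foldr; upTo)
open import Data.Bool.ListAction using (all; any)
open import Data.Nat.ListAction using (sum)
open import Data.Product using (Σ; _×_; _,_)
open import Relation.Binary.PropositionalEquality using (_≡_; _≢_)
open import Relation.Nullary.Decidable using (⌊_⌋)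

record Digraph : Set where
  field
    n        : ℕ
    arc      : Fin n → Fin n → Bool
    loopless : ∀ u → arc u u ≡ false

open Digraph public

_==ᵇ_ : Bool → Bool → Bool
true  ==ᵇ b = b
false ==ᵇ b = not b

_==ᶠ_ : ∀ {k} → Fin k → Fin k → Bool
a ==ᶠ b = ⌊ a ≟ᶠ b ⌋

-- d-nw (directed neighbourhood width)
-- A layout φ : V → {1..n} is a permutation of Fin n; φ(u) = toℕ (φ ⟨$⟩ʳ u) + 1.

module NW (G : Digraph) (φ : Permutation′ (n G)) where

  -- u ∈ L(i,φ)  iff  φ(u) ≤ i
  inL : ℕ → Fin (n G) → Bool
  inL i u = toℕ (φ ⟨$⟩ʳ u) <ᵇ i

  -- N_i(u) = N_i(v)  (both out- and in-neighbourhoods restricted to R(i,φ))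
  sameNb : ℕ → Fin (n G) → Fin (n G) → Bool
  sameNb i u v = all (λ w → if inL i w then true
                            else ((arc G u w ==ᵇ arc G v w) ∧ (arc G w u ==ᵇ arc G w v)))
                     (allFin (n G))

  -- |{ N_i(u) : u ∈ L(i,φ) }| : count the u ∈ L(i,φ) whose neighbourhood
  -- differs from that of every v ∈ L(i,φ) with smaller index (class representatives)
  numNb : ℕ → ℕ
  numNb i = sum (map (λ u → if inL i u ∧ not (any (λ v → inL i v ∧ (toℕ v <ᵇ toℕ u) ∧ sameNb i v u)
                                                  (allFin (n G)))
                            then 1 else 0)
                     (allFin (n G)))

  width : ℕ
  width = foldr _⊔_ 0 (map numNb (upTo (suc (n G))))

IsDnw : Digraph → ℕ → Set
IsDnw G k = Σ (Permutation′ (n G)) (λ φ → NW.width G φ ≡ k)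
          × (∀ (φ : Permutation′ (n G)) → k ≤ NW.width G φ)

record LDigraph (k : ℕ) : Set where
  field
    m    : ℕ
    larc : Fin m → Fin m → Bool
    lab  : Fin m → Fin k

open LDigraph public

IsoTo : ∀ {k} → LDigraph k → Digraph → Set
IsoTo H G = Σ (Permutation (m H) (n G))
              (λ σ → ∀ u v → larc H u v ≡ arc G (σ ⟨$⟩ʳ u) (σ ⟨$⟩ʳ v))

single : ∀ {k} → Fin k → LDigraph k
single a = record { m = 1 ; larc = λ _ _ → false ; lab = λ _ → a }

-- add a new vertex (index zero) labelled a, with arcs given by
-- inc u (arc (old u → new)) and out u (arc (new → old u))
extend : ∀ {k} → (H : LDigraph k) → (inc out : Fin (m H) → Bool) → Fin k → LDigraph k
extend H inc out a = record { m = suc (m H) ; larc = ar ; lab = lb }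
  where
  ar : Fin (suc (m H)) → Fin (suc (m H)) → Bool
  ar zero    zero    = false
  ar zero    (suc v) = out v
  ar (suc u) zero    = inc u
  ar (suc u) (suc v) = larc H u v
  lb : Fin (suc (m H)) → Fin _
  lb zero    = a
  lb (suc u) = lab H u

data NLCExpr (k : ℕ) : Set where
  •_   : Fin k → NLCExpr k
  -- H ⊗_(S→,S←) •_a ; S→, S← ⊆ [k]² given by their characteristic functions
  _⊗[_,_]•_ : NLCExpr k → (Sout Sin : Fin k → Fin k → Bool) → Fin k → NLCExpr k
  relab : (Fin k → Fin k) → NLCExpr k → NLCExpr k

⟦_⟧ⁿ : ∀ {k} → NLCExpr k → LDigraph k
⟦ • a ⟧ⁿ = single a
⟦ e ⊗[ S→ , S← ]• a ⟧ⁿ =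
  let H = ⟦ e ⟧ⁿ in extend H (λ u → S→ (lab H u) a) (λ u → S← (lab H u) a) a
⟦ relab R e ⟧ⁿ =
  let H = ⟦ e ⟧ⁿ in record { m = m H ; larc = larc H ; lab = λ u → R (lab H u) }

HasLnlcw : Digraph → ℕ → Set
HasLnlcw G k = Σ (NLCExpr k) (λ e → IsoTo ⟦ e ⟧ⁿ G)

IsDlnlcw : Digraph → ℕ → Set
IsDlnlcw G k = HasLnlcw G k × (∀ j → HasLnlcw G j → k ≤ j)

data CWExpr (k : ℕ) : Set where
  •_    : Fin k → CWExpr k
  _⊕•_  : CWExpr k → Fin k → CWExpr k
  α     : (a b : Fin k) → a ≢ b → CWExpr k → CWExpr k
  ρ     : (a b : Fin k) → CWExpr k → CWExpr k

⟦_⟧ᶜ : ∀ {k} → CWExpr k → LDigraph k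
⟦ • a ⟧ᶜ = single a
⟦ e ⊕• a ⟧ᶜ = extend ⟦ e ⟧ᶜ (λ _ → false) (λ _ → false) a
⟦ α a b _ e ⟧ᶜ =
  let H = ⟦ e ⟧ᶜ in
  record { m = m H
         ; larc = λ u v → larc H u v ∨ ((lab H u ==ᶠ a) ∧ (lab H v ==ᶠ b))
         ; lab = lab H }
⟦ ρ a b e ⟧ᶜ =
  let H = ⟦ e ⟧ᶜ in
  record { m = m H ; larc = larc H
         ; lab = λ u → if lab H u ==ᶠ a then b else lab H u }

HasLcw : Digraph → ℕ → Set
HasLcw G k = Σ (CWExpr k) (λ e → IsoTo ⟦ e ⟧ᶜ G)

IsDlcw : Digraph → ℕ → Set
IsDlcw G k = HasLcw G k × (∀ j → HasLcw G j → k ≤ j)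

data Param : Set where
  d-nw d-lnlcw d-lcw : Param

IsParam : Param → Digraph → ℕ → Set
IsParam d-nw     = IsDnw
IsParam d-lnlcw  = IsDlnlcw
IsParam d-lcw    = IsDlcw

lin : ℕ → ℕ → ℕ → ℕ
lin a b x = a * x + b

module Submission where

-- Neighbourhood width serves as a hub, reached through four translations:
--   * a linear clique-width expression becomes a linear NLC expression with the
--     same labels; the arcs added by α are kept pending until their later
--     endpoint is inserted                                (d-lnlcw ≤ d-lcw);
--   * a linear NLC expression with k labels becomes a linear clique-width
--     expression with 2k labels, the second copy serving as scratch labels
--                                                         (d-lcw ≤ 2 d-lnlcw);
--   * the insertion order of a linear NLC expression with k labels is a layout
--     of neighbourhood width at most k, since at every cut the inserted vertices
--     with equal labels have equal neighbours among the later ones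
--                                                         (d-nw ≤ d-lnlcw);
--   * a layout of width W yields a linear NLC expression with W + 1 labels that
--     labels every inserted vertex by its neighbourhood class (d-lnlcw ≤ d-nw + 1).
-- So d-nw(G) ≤ p(G) ≤ slope p · d-nw(G) + intercept p for every parameter p,
-- and any two parameters bound each other linearly.

open import Defs
open import Data.Nat using (ℕ; zero; suc; _+_; _*_; _∸_; _≤_; _<_; _<ᵇ_; _⊔_; _≤?_; _<?_; z≤n; s≤s)
open import Data.Nat.Properties
  using ( ≤-trans; ≤-reflexive; ≤-pred; <-trans; <-≤-trans; ≤-<-trans; <-irrefl; <-cmp
        ; <⇒≤; ≤⇒≯; ≮⇒≥; n≤1+n; n<1+n; m≤n⇒m≤1+n; m≤m+n; <ᵇ⇒<; <⇒<ᵇ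
        ; +-identityʳ; +-suc; +-monoˡ-≤; +-monoʳ-<; *-monoʳ-≤; m∸n≤m; m∸n+n≡m; m+[n∸m]≡n
        ; ⊔-lub; m≤m⊔n; m≤n⊔m; module ≤-Reasoning )
open import Data.Nat.ListAction using (sum)
open import Data.Nat.Induction using (<-wellFounded)
open import Data.Nat.Tactic.RingSolver using (solve-∀)
open import Data.Bool using (Bool; true; false; T; T?; _∧_; _∨_; not; if_then_else_)
open import Data.Bool.Properties using (∨-assoc; ∨-comm; ∨-identityʳ; ∨-zeroʳ; ∧-zeroʳ; T-∧; T-≡)
open import Data.Bool.ListAction using (all; any)
open import Data.Fin using (Fin; zero; suc; toℕ; fromℕ; fromℕ<; opposite; cast; _↑ˡ_; _↑ʳ_; splitAt)
open import Data.Fin.Properties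
  using ( _≟_; toℕ<n; toℕ-injective; toℕ-fromℕ; toℕ-fromℕ<; toℕ-cast; opposite-prop; injective⇒≤
        ; splitAt-↑ˡ; splitAt-↑ʳ; ↑ˡ-injective; ↑ʳ-injective )
open import Data.Fin.Permutation
  using ( Permutation; Permutation′; _⟨$⟩ʳ_; _⟨$⟩ˡ_; _∘ₚ_; id; flip; lift₀; reverse; cast-id
        ; inverseʳ; ↔⇒≡ )
open import Data.List using (List; []; _∷_; map; foldr; length; lookup; allFin; upTo; filterᵇ; cartesianProduct)
open import Data.List.Properties using (length-map)
open import Data.List.Membership.Propositional using (_∈_)
open import Data.List.Membership.Propositional.Properties
  using (∈-allFin; ∈-lookup; ∈-filter⁺; ∈-upTo⁺; ∈-cartesianProduct⁺)
open import Data.List.Relation.Unary.All as All using (All; []; _∷_)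
import Data.List.Relation.Unary.All.Properties as AllP
open import Data.List.Relation.Unary.AllPairs using (AllPairs; []; _∷_)
import Data.List.Relation.Unary.AllPairs.Properties as AllPairsP
open import Data.List.Relation.Unary.Any as Any using (here; there; satisfied)
import Data.List.Relation.Unary.Any.Properties as AnyP
open import Data.List.Relation.Unary.Unique.Propositional.Properties using (allFin⁺)
open import Data.Product using (Σ; ∃; _×_; _,_; proj₁; proj₂)
open import Data.Sum using (inj₁; inj₂)
open import Data.Unit using (⊤; tt)
open import Data.Empty using (⊥-elim)
open import Function using (_∘_; Equivalence)
open import Induction.WellFounded using (Acc; acc)
open import Relation.Binary using (tri<; tri≈; tri>)
open import Relation.Binary.PropositionalEquality
  using (_≡_; _≢_; refl; sym; trans; cong; cong₂; subst; module ≡-Reasoning)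
open import Relation.Nullary using (¬_; yes; no)
open import Relation.Nullary.Decidable using (fromWitness)

T-ext : ∀ {a b : Bool} → (T a → T b) → (T b → T a) → a ≡ b
T-ext {false} {false} _ _ = refl
T-ext {false} {true}  _ g = ⊥-elim (g _)
T-ext {true}  {false} f _ = ⊥-elim (f _)
T-ext {true}  {true}  _ _ = refl

==ᶠ-refl : ∀ {k} (x : Fin k) → T (x ==ᶠ x)
==ᶠ-refl x = fromWitness refl

==ᶠ-≢ : ∀ {k} {x y : Fin k} → x ≢ y → (x ==ᶠ y) ≡ false
==ᶠ-≢ {x = x} {y} x≢y with x ≟ y
... | yes x≡y = ⊥-elim (x≢y x≡y)
... | no _    = refl

any-select : ∀ {A : Set} (eq : A → A → Bool) → (∀ {x y} → T (eq x y) → x ≡ y) →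
             (Q : A → Bool) {xs : List A} {c : A} → T (eq c c) → c ∈ xs →
             any (λ x → Q x ∧ eq c x) xs ≡ Q c
any-select eq sound Q {xs} {c} eq-cc c∈xs = T-ext found present
  where
  found : T (any (λ x → Q x ∧ eq c x) xs) → T (Q c)
  found h with satisfied (AnyP.any⁻ _ xs h)
  ... | x , Qx∧c=x with Equivalence.to T-∧ Qx∧c=x
  ...   | Qx , c=x with sound {c} {x} c=x
  ...     | refl = Qx
  present : T (Q c) → T (any (λ x → Q x ∧ eq c x) xs)
  present Qc = AnyP.any⁺ _ (Any.map (λ { refl → Equivalence.from T-∧ (Qc , eq-cc) }) c∈xs)

==ᵇ-sound : ∀ {a b} → T (a ==ᵇ b) → a ≡ b
==ᵇ-sound {true}  {true}  _ = refl
==ᵇ-sound {false} {false} _ = refl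

==ᵇ-refl : ∀ a → T (a ==ᵇ a)
==ᵇ-refl true  = _
==ᵇ-refl false = _

count≡length-filter : ∀ {A : Set} (p : A → Bool) xs →
                      sum (map (λ x → if p x then 1 else 0) xs) ≡ length (filterᵇ p xs)
count≡length-filter p []       = refl
count≡length-filter p (x ∷ xs) with p x
... | true  = cong suc (count≡length-filter p xs)
... | false = count≡length-filter p xs

lookup-injective : ∀ {A : Set} {xs : List A} → AllPairs _≢_ xs → ∀ {i j} → lookup xs i ≡ lookup xs j → i ≡ j
lookup-injective (_ ∷ _)        {zero}  {zero}  _  = refl
lookup-injective (x∉xs ∷ _)     {zero}  {suc j} x≡ = ⊥-elim (All.lookup x∉xs (∈-lookup j) x≡)
lookup-injective (x∉xs ∷ _)     {suc i} {zero}  ≡x = ⊥-elim (All.lookup x∉xs (∈-lookup i) (sym ≡x))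
lookup-injective (_ ∷ distinct) {suc i} {suc j} eq = cong suc (lookup-injective distinct eq)

distinct-length : ∀ {k} {ys : List (Fin k)} → AllPairs _≢_ ys → length ys ≤ k
distinct-length distinct = injective⇒≤ (lookup-injective distinct)

allPairs-with : ∀ {A : Set} {P : A → Set} {R S : A → A → Set} {xs} →
                All P xs → AllPairs R xs → (∀ {x y} → P x → P y → R x y → S x y) → AllPairs S xs
allPairs-with []         []         _ = []
allPairs-with (px ∷ pxs) (rx ∷ rxs) f =
  All.zipWith (λ (py , r) → f px py r) (pxs , rx) ∷ allPairs-with pxs rxs f

max-upper : ∀ {A : Set} (g : A → ℕ) {xs x} → x ∈ xs → g x ≤ foldr _⊔_ 0 (map g xs)
max-upper g (here refl) = m≤m⊔n _ _
max-upper g {y ∷ _} (there x∈xs) = ≤-trans (max-upper g x∈xs) (m≤n⊔m (g y) _)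

max-least : ∀ {A : Set} (g : A → ℕ) xs {k} → (∀ x → g x ≤ k) → foldr _⊔_ 0 (map g xs) ≤ k
max-least g []       _   = z≤n
max-least g (x ∷ xs) g≤k = ⊔-lub (g≤k x) (max-least g xs g≤k)

-- The position of the first entry satisfying p (the length if there is none),
-- and the entry at a position (a default d beyond the end).
firstIndex : ∀ {A : Set} → (A → Bool) → List A → ℕ
firstIndex p []       = 0
firstIndex p (x ∷ xs) = if p x then 0 else suc (firstIndex p xs)

entry : ∀ {A : Set} → A → List A → ℕ → A
entry d []       _       = d
entry d (x ∷ xs) zero    = x
entry d (x ∷ xs) (suc c) = entry d xs c

firstIndex-< : ∀ {A : Set} (p : A → Bool) xs → T (any p xs) → firstIndex p xs < length xs
firstIndex-< p (x ∷ xs) found with p x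
... | true  = s≤s z≤n
... | false = s≤s (firstIndex-< p xs found)

firstIndex-entry : ∀ {A : Set} (d : A) (p : A → Bool) xs → T (any p xs) →
                   T (p (entry d xs (firstIndex p xs)))
firstIndex-entry d p (x ∷ xs) found with p x in px
... | true  = subst T (sym px) _
... | false = firstIndex-entry d p xs found

firstIndex-cong : ∀ {A : Set} {p q : A → Bool} → (∀ x → p x ≡ q x) → ∀ xs → firstIndex p xs ≡ firstIndex q xs
firstIndex-cong p≗q []       = refl
firstIndex-cong p≗q (x ∷ xs) rewrite p≗q x | firstIndex-cong p≗q xs = refl

clamp : ∀ {K} → Fin K → ℕ → Fin K
clamp {K} default c with c <? K
... | yes c<K = fromℕ< c<K
... | no  _   = default

toℕ-clamp : ∀ {K} (default : Fin K) {c} → c < K → toℕ (clamp default c) ≡ c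
toℕ-clamp {K} default {c} c<K with c <? K
... | yes c<K′ = toℕ-fromℕ< c<K′
... | no  c≮K  = ⊥-elim (c≮K c<K)

clamp-toℕ : ∀ {K} (default : Fin K) (q : Fin K) → clamp default (toℕ q) ≡ q
clamp-toℕ default q = toℕ-injective (toℕ-clamp default (toℕ<n q))

<ᵇ-irrefl : ∀ n → (n <ᵇ n) ≡ false
<ᵇ-irrefl zero    = refl
<ᵇ-irrefl (suc n) = <ᵇ-irrefl n

iso-pull : ∀ {k₁ k₂} {H₁ : LDigraph k₁} {H₂ : LDigraph k₂} {G : Digraph}
           (σ : Permutation (m H₁) (m H₂)) →
           (∀ u v → larc H₁ u v ≡ larc H₂ (σ ⟨$⟩ʳ u) (σ ⟨$⟩ʳ v)) →
           IsoTo H₂ G → IsoTo H₁ G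
iso-pull σ arcs (τ , arcs′) = σ ∘ₚ τ , λ u v → trans (arcs u v) (arcs′ _ _)

iso-push : ∀ {k₁ k₂} {H₁ : LDigraph k₁} {H₂ : LDigraph k₂} {G : Digraph}
           (σ : Permutation (m H₁) (m H₂)) →
           (∀ u v → larc H₁ u v ≡ larc H₂ (σ ⟨$⟩ʳ u) (σ ⟨$⟩ʳ v)) →
           IsoTo H₁ G → IsoTo H₂ G
iso-push {H₂ = H₂} σ arcs (τ , arcs′) = flip σ ∘ₚ τ , arcs″
  where
  arcs″ : ∀ x y → larc H₂ x y ≡ _
  arcs″ x y = trans (cong₂ (larc H₂) (sym (inverseʳ σ)) (sym (inverseʳ σ)))
                    (trans (sym (arcs _ _)) (arcs′ _ _))

rename : ∀ {k} → Fin k → Fin k → Fin k → Fin k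
rename a b x = if x ==ᶠ a then b else x

-- An NLC expression cannot add arcs between existing vertices, so the arcs that
-- later α-operations of a clique-width expression would add are carried along as
-- a predicate F on current labels and created together with their later endpoint.
toNLC : ∀ {k} → CWExpr k → (Fin k → Fin k → Bool) → NLCExpr k
toNLC (• a)       F = • a
toNLC (e ⊕• a)    F = toNLC e F ⊗[ F , (λ b c → F c b) ]• a
toNLC (α a b _ e) F = toNLC e (λ x y → F x y ∨ ((x ==ᶠ a) ∧ (y ==ᶠ b)))
toNLC (ρ a b e)   F = relab (rename a b) (toNLC e (λ x y → F (rename a b x) (rename a b y)))

-- N realises C with pending arcs F: a relabelling-free copy of C in which the
-- arcs u → v between distinct vertices with F (label u) (label v) are added.
Realises : ∀ {k} → (Fin k → Fin k → Bool) → LDigraph k → LDigraph k → Set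
Realises F N C = Σ (Permutation (m N) (m C)) λ σ →
  (∀ u v → larc N u v ≡ (larc C (σ ⟨$⟩ʳ u) (σ ⟨$⟩ʳ v)
                         ∨ (not (u ==ᶠ v) ∧ F (lab C (σ ⟨$⟩ʳ u)) (lab C (σ ⟨$⟩ʳ v)))))
  × (∀ u → lab N u ≡ lab C (σ ⟨$⟩ʳ u))

-- Boolean core of the α-case: the arcs of α a b are pending or present, except on
-- the diagonal, where α adds nothing since a ≢ b.
move-pending : ∀ L d F P → (d ≡ false → P ≡ false) →
               (L ∨ (d ∧ (F ∨ P))) ≡ ((L ∨ P) ∨ (d ∧ F))
move-pending L false F P P-off rewrite P-off refl = sym (∨-identityʳ (L ∨ false))
move-pending L true  F P _ =
  trans (cong (L ∨_) (∨-comm F P)) (sym (∨-assoc L P F))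

suc-==ᶠ : ∀ {k} (x y : Fin k) → (suc x ==ᶠ suc y) ≡ (x ==ᶠ y)
suc-==ᶠ x y with x ≟ y
... | yes _ = refl
... | no _  = refl

realises : ∀ {k} (e : CWExpr k) F → Realises F ⟦ toNLC e F ⟧ⁿ ⟦ e ⟧ᶜ
realises (• a) F = id , (λ { zero zero → refl }) , λ { zero → refl }
realises (e ⊕• a) F with realises e F
... | σ , arcs , labs = lift₀ σ , arcs′ , labs′
  where
  arcs′ : ∀ u v → _
  arcs′ zero    zero    = refl
  arcs′ zero    (suc v) rewrite labs v = refl
  arcs′ (suc u) zero    rewrite labs u = refl
  arcs′ (suc u) (suc v) rewrite suc-==ᶠ u v = arcs u v
  labs′ : ∀ u → _
  labs′ zero    = refl
  labs′ (suc u) = labs u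
realises (α a b a≢b e) F with realises e (λ x y → F x y ∨ ((x ==ᶠ a) ∧ (y ==ᶠ b)))
... | σ , arcs , labs = σ , arcs′ , labs
  where
  C = ⟦ e ⟧ᶜ
  off-diagonal : ∀ u v → not (u ==ᶠ v) ≡ false →
                 ((lab C (σ ⟨$⟩ʳ u) ==ᶠ a) ∧ (lab C (σ ⟨$⟩ʳ v) ==ᶠ b)) ≡ false
  off-diagonal u v with u ≟ v
  ... | no _     = λ ()
  ... | yes refl with lab C (σ ⟨$⟩ʳ u) ≟ a
  ...   | no _     = λ _ → refl
  ...   | yes l≡a  = λ _ → ==ᶠ-≢ (λ l≡b → a≢b (trans (sym l≡a) l≡b))
  arcs′ : ∀ u v → _
  arcs′ u v = trans (arcs u v) (move-pending _ (not (u ==ᶠ v)) _ _ (off-diagonal u v))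
realises (ρ a b e) F with realises e (λ x y → F (rename a b x) (rename a b y))
... | σ , arcs , labs = σ , arcs , λ u → cong (rename a b) (labs u)

lcw⇒lnlcw : ∀ {G k} → HasLcw G k → HasLnlcw G k
lcw⇒lnlcw {G} (e , iso) with realises e (λ _ _ → false)
... | σ , arcs , _ =
  toNLC e (λ _ _ → false) , iso-pull {H₁ = ⟦ toNLC e (λ _ _ → false) ⟧ⁿ} {H₂ = ⟦ e ⟧ᶜ} {G = G} σ arcs′ iso
  where
  arcs′ : ∀ u v → larc ⟦ toNLC e (λ _ _ → false) ⟧ⁿ u v ≡ larc ⟦ e ⟧ᶜ (σ ⟨$⟩ʳ u) (σ ⟨$⟩ʳ v)
  arcs′ u v = trans (arcs u v)
                    (trans (cong (larc ⟦ e ⟧ᶜ (σ ⟨$⟩ʳ u) (σ ⟨$⟩ʳ v) ∨_) (∧-zeroʳ (not (u ==ᶠ v))))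
                           (∨-identityʳ _))

record Step {k k′ : ℕ} (P : Fin k → Fin k → Bool) (Q : Fin k → Fin k′)
            (H : LDigraph k) (H′ : LDigraph k′) : Set where
  constructor step
  field
    σ    : Permutation (m H) (m H′)
    arcs : ∀ u v → larc H′ (σ ⟨$⟩ʳ u) (σ ⟨$⟩ʳ v) ≡ (larc H u v ∨ P (lab H u) (lab H v))
    labs : ∀ u → lab H′ (σ ⟨$⟩ʳ u) ≡ Q (lab H u)

module _ {k₁ k₂ k₃ : ℕ} {H₁ : LDigraph k₁} {H₂ : LDigraph k₂} {H₃ : LDigraph k₃} where

  step-∘ : ∀ {P Q P′ Q′} → Step P Q H₁ H₂ → Step P′ Q′ H₂ H₃ →
           Step (λ x y → P x y ∨ P′ (Q x) (Q y)) (Q′ ∘ Q) H₁ H₃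
  step-∘ {P} {Q} {P′} {Q′} (step σ arcs labs) (step τ arcs′ labs′) = step (σ ∘ₚ τ) arcs″ labs″
    where
    open ≡-Reasoning
    arcs″ : ∀ u v → larc H₃ (τ ⟨$⟩ʳ (σ ⟨$⟩ʳ u)) (τ ⟨$⟩ʳ (σ ⟨$⟩ʳ v)) ≡ _
    arcs″ u v = begin
      larc H₃ (τ ⟨$⟩ʳ (σ ⟨$⟩ʳ u)) (τ ⟨$⟩ʳ (σ ⟨$⟩ʳ v))
        ≡⟨ arcs′ _ _ ⟩
      larc H₂ (σ ⟨$⟩ʳ u) (σ ⟨$⟩ʳ v) ∨ P′ (lab H₂ (σ ⟨$⟩ʳ u)) (lab H₂ (σ ⟨$⟩ʳ v))
        ≡⟨ cong₂ _∨_ (arcs u v) (cong₂ P′ (labs u) (labs v)) ⟩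
      (larc H₁ u v ∨ P (lab H₁ u) (lab H₁ v)) ∨ P′ (Q (lab H₁ u)) (Q (lab H₁ v))
        ≡⟨ ∨-assoc (larc H₁ u v) _ _ ⟩
      larc H₁ u v ∨ (P (lab H₁ u) (lab H₁ v) ∨ P′ (Q (lab H₁ u)) (Q (lab H₁ v)))
        ∎
    labs″ : ∀ u → lab H₃ (τ ⟨$⟩ʳ (σ ⟨$⟩ʳ u)) ≡ Q′ (Q (lab H₁ u))
    labs″ u = trans (labs′ _) (cong Q′ (labs u))

step-cong : ∀ {k k′} {H : LDigraph k} {H′ : LDigraph k′} {P P′ Q Q′} →
            (∀ x y → P x y ≡ P′ x y) → (∀ x → Q x ≡ Q′ x) → Step P Q H H′ → Step P′ Q′ H H′
step-cong P≗P′ Q≗Q′ (step σ arcs labs) =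
  step σ (λ u v → trans (arcs u v) (cong (_ ∨_) (P≗P′ _ _))) λ u → trans (labs u) (Q≗Q′ _)

step-refl : ∀ {k} {H : LDigraph k} → Step (λ _ _ → false) (λ x → x) H H
step-refl = step id (λ u v → sym (∨-identityʳ _)) λ u → refl

module CliqueWidthCombinators {K : ℕ} where

  _==²_ : Fin K × Fin K → Fin K × Fin K → Bool
  (a , b) ==² (x , y) = (a ==ᶠ x) ∧ (b ==ᶠ y)

  ==²-sound : ∀ {p q} → T (p ==² q) → p ≡ q
  ==²-sound {a , b} {x , y} h with a ≟ x | b ≟ y
  ... | yes refl | yes refl = refl

  ==²-refl : ∀ p → T (p ==² p)
  ==²-refl (a , b) rewrite Equivalence.to T-≡ (==ᶠ-refl a) = ==ᶠ-refl b

  αIf : (Fin K → Fin K → Bool) → Fin K × Fin K → CWExpr K → CWExpr K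
  αIf P (x , y) e with x ≟ y
  ... | yes _  = e
  ... | no x≢y = if P x y then α x y x≢y e else e

  Proper : (Fin K → Fin K → Bool) → Fin K × Fin K → Bool
  Proper P (x , y) = not (x ==ᶠ y) ∧ P x y

  αIf-step : ∀ P p (e : CWExpr K) →
             Step (λ a b → Proper P p ∧ ((a , b) ==² p)) (λ x → x) ⟦ e ⟧ᶜ ⟦ αIf P p e ⟧ᶜ
  αIf-step P (x , y) e with x ≟ y
  ... | yes _ = step-refl
  ... | no _ with P x y
  ...   | true  = step id (λ u v → refl) λ u → refl
  ...   | false = step-refl

  addArcs : (Fin K → Fin K → Bool) → CWExpr K → CWExpr K
  addArcs P e = foldr (αIf P) e (cartesianProduct (allFin K) (allFin K))

  addArcs-step : ∀ P (e : CWExpr K) →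
                 Step (λ a b → not (a ==ᶠ b) ∧ P a b) (λ x → x) ⟦ e ⟧ᶜ ⟦ addArcs P e ⟧ᶜ
  addArcs-step P e = step-cong (λ a b → any-select _==²_ ==²-sound (Proper P) (==²-refl (a , b))
                                           (∈-cartesianProduct⁺ (∈-allFin a) (∈-allFin b)))
                               (λ _ → refl) (along (cartesianProduct (allFin K) (allFin K)))
    where
    along : ∀ ps → Step (λ a b → any (λ p → Proper P p ∧ ((a , b) ==² p)) ps) (λ x → x)
                        ⟦ e ⟧ᶜ ⟦ foldr (αIf P) e ps ⟧ᶜ
    along []       = step-refl
    along (p ∷ ps) = step-cong (λ a b → ∨-comm (any (λ q → Proper P q ∧ ((a , b) ==² q)) ps) _)
                               (λ _ → refl) (step-∘ (along ps) (αIf-step P p (foldr (αIf P) e ps)))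

  renameAll : ∀ {k} → (f g : Fin k → Fin K) → List (Fin k) → CWExpr K → CWExpr K
  renameAll f g as e = foldr (λ a → ρ (f a) (g a)) e as

  renamings : ∀ {k} → (f g : Fin k → Fin K) → List (Fin k) → Fin K → Fin K
  renamings f g as x = foldr (λ a → rename (f a) (g a)) x as

  renameAll-step : ∀ {k} (f g : Fin k → Fin K) as (e : CWExpr K) →
                   Step (λ _ _ → false) (renamings f g as) ⟦ e ⟧ᶜ ⟦ renameAll f g as e ⟧ᶜ
  renameAll-step f g []       e = step-refl
  renameAll-step f g (a ∷ as) e =
    step-∘ (renameAll-step f g as e) (ρ-step (f a) (g a) (renameAll f g as e))
    where
    ρ-step : ∀ a b (e : CWExpr K) → Step (λ _ _ → false) (rename a b) ⟦ e ⟧ᶜ ⟦ ρ a b e ⟧ᶜ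
    ρ-step a b e = step id (λ u v → sym (∨-identityʳ _)) λ u → refl

  renamings-image : ∀ {k} (f g : Fin k → Fin K) → (∀ {a b} → f a ≡ f b → a ≡ b) →
                    (∀ {a b} → g a ≢ f b) → ∀ as c →
                    renamings f g as (f c) ≡ (if any (c ==ᶠ_) as then g c else f c)
  renamings-image f g f-inj g≢f []       c = refl
  renamings-image f g f-inj g≢f (a ∷ as) c
    rewrite renamings-image f g f-inj g≢f as c with any (c ==ᶠ_) as
  ... | true  rewrite ==ᶠ-≢ (g≢f {c} {a}) | ∨-zeroʳ (c ==ᶠ a) = refl
  ... | false rewrite ∨-identityʳ (c ==ᶠ a) with c ≟ a
  ...   | yes refl rewrite Equivalence.to T-≡ (==ᶠ-refl (f c)) = refl
  ...   | no c≢a   rewrite ==ᶠ-≢ (λ fc≡fa → c≢a (f-inj fc≡fa)) = refl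

  renamings-all : ∀ {k} (f g : Fin k → Fin K) → (∀ {a b} → f a ≡ f b → a ≡ b) →
                  (∀ {a b} → g a ≢ f b) → ∀ c → renamings f g (allFin k) (f c) ≡ g c
  renamings-all f g f-inj g≢f c
    rewrite renamings-image f g f-inj g≢f (allFin _) c
          | Equivalence.to T-≡ (AnyP.any⁺ (c ==ᶠ_) (Any.map (λ { refl → ==ᶠ-refl c }) (∈-allFin c))) = refl

-- Linear NLC-width k is simulated by linear clique-width 2k: every NLC label a is
-- represented by the "low" label lo a, and the "high" copies are scratch labels
-- for the vertex being inserted and for relabelling without merging classes.
module Doubling (k : ℕ) where
  open CliqueWidthCombinators {k + k}

  lo hi : Fin k → Fin (k + k)
  lo a = a ↑ˡ k
  hi a = k ↑ʳ a

  lo-injective : ∀ {a b} → lo a ≡ lo b → a ≡ b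
  lo-injective = ↑ˡ-injective k _ _

  hi-injective : ∀ {a b} → hi a ≡ hi b → a ≡ b
  hi-injective = ↑ʳ-injective k _ _

  hi≢lo : ∀ {a b} → hi a ≢ lo b
  hi≢lo {a} {b} hi≡lo with trans (sym (splitAt-↑ʳ k k a)) (trans (cong (splitAt k) hi≡lo) (splitAt-↑ˡ k b k))
  ... | ()

  -- The arcs an NLC insertion step creates, read on doubled labels: from lo b to
  -- the new vertex hi a if S→ b a, and from hi a to lo b if S← b a.
  insertionArcs : (S→ S← : Fin k → Fin k → Bool) → Fin (k + k) → Fin (k + k) → Bool
  insertionArcs S→ S← x y with splitAt k x | splitAt k y
  ... | inj₁ b | inj₂ a = S→ b a
  ... | inj₂ a | inj₁ b = S← b a
  ... | _      | _      = false

  toCW : NLCExpr k → CWExpr (k + k)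
  toCW (• a)                 = • lo a
  toCW (e ⊗[ S→ , S← ]• a)   = ρ (hi a) (lo a) (addArcs (insertionArcs S→ S←) (toCW e ⊕• hi a))
  toCW (relab R e)           = renameAll hi (lo ∘ R) (allFin k) (renameAll lo hi (allFin k) (toCW e))

  simulates : ∀ e → Step (λ _ _ → false) lo ⟦ e ⟧ⁿ ⟦ toCW e ⟧ᶜ
  simulates (• a) = step id (λ { zero zero → refl }) λ { zero → refl }
  simulates (relab R e)
    with step-∘ (step-∘ (simulates e) (renameAll-step lo hi (allFin k) (toCW e)))
                (renameAll-step hi (lo ∘ R) (allFin k) (renameAll lo hi (allFin k) (toCW e)))
  ... | step σ arcs labs = step σ arcs λ u → trans (labs u) (relabel (lab ⟦ e ⟧ⁿ u))
    where
    relabel : ∀ c → renamings hi (lo ∘ R) (allFin k) (renamings lo hi (allFin k) (lo c)) ≡ lo (R c)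
    relabel c rewrite renamings-all lo hi lo-injective hi≢lo c
      = renamings-all hi (lo ∘ R) hi-injective (λ lo≡hi → hi≢lo (sym lo≡hi)) c
  simulates (e ⊗[ S→ , S← ]• a)
    with simulates e | addArcs-step (insertionArcs S→ S←) (toCW e ⊕• hi a)
  ... | step σ arcs labs | step τ arcs′ labs′ = step (lift₀ σ ∘ₚ τ) arcs″ labs″
    where
    N = ⟦ e ⟧ⁿ
    added : Fin (k + k) → Fin (k + k) → Bool
    added x y = not (x ==ᶠ y) ∧ insertionArcs S→ S← x y
    lo≢hi : ∀ {b} → lo b ≢ hi a
    lo≢hi lo≡hi = hi≢lo (sym lo≡hi)
    added-old-old : ∀ b c → added (lo b) (lo c) ≡ false
    added-old-old b c rewrite splitAt-↑ˡ k b k | splitAt-↑ˡ k c k = ∧-zeroʳ _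
    added-old-new : ∀ c → added (lo c) (hi a) ≡ S→ c a
    added-old-new c rewrite splitAt-↑ˡ k c k | splitAt-↑ʳ k k a | ==ᶠ-≢ (lo≢hi {c}) = refl
    added-new-old : ∀ c → added (hi a) (lo c) ≡ S← c a
    added-new-old c rewrite splitAt-↑ʳ k k a | splitAt-↑ˡ k c k | ==ᶠ-≢ (hi≢lo {a} {c}) = refl
    added-new-new : added (hi a) (hi a) ≡ false
    added-new-new rewrite splitAt-↑ʳ k k a = ∧-zeroʳ _
    arcs″ : ∀ u v → _
    arcs″ zero    zero    rewrite arcs′ zero zero = added-new-new
    arcs″ zero    (suc v) rewrite arcs′ zero (suc (σ ⟨$⟩ʳ v)) | labs v
      = trans (added-new-old (lab N v)) (sym (∨-identityʳ _))
    arcs″ (suc u) zero    rewrite arcs′ (suc (σ ⟨$⟩ʳ u)) zero | labs u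
      = trans (added-old-new (lab N u)) (sym (∨-identityʳ _))
    arcs″ (suc u) (suc v) rewrite arcs′ (suc (σ ⟨$⟩ʳ u)) (suc (σ ⟨$⟩ʳ v)) | labs u | labs v
                                | added-old-old (lab N u) (lab N v) = trans (∨-identityʳ _) (arcs u v)
    labs″ : ∀ u → _
    labs″ zero    rewrite labs′ zero | Equivalence.to T-≡ (==ᶠ-refl (hi a)) = refl
    labs″ (suc u) rewrite labs′ (suc (σ ⟨$⟩ʳ u)) | labs u | ==ᶠ-≢ (lo≢hi {lab N u}) = refl

lnlcw⇒lcw : ∀ {G k} → HasLnlcw G k → HasLcw G (k + k)
lnlcw⇒lcw {G} {k} (e , iso) with Doubling.simulates k e
... | step σ arcs _ =
  Doubling.toCW k e ,
  iso-push {H₁ = ⟦ e ⟧ⁿ} {H₂ = ⟦ Doubling.toCW k e ⟧ᶜ} {G = G} σ (λ u v → sym (trans (arcs u v) (∨-identityʳ _))) iso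

-- Neighbourhood classes of a layout φ at the cut i: L(i) is the set of the first
-- i vertices, and two vertices are equivalent if they have the same in- and
-- out-neighbours outside L(i).
module Neighbourhoods (G : Digraph) (φ : Permutation′ (n G)) where
  open NW G φ public

  N : ℕ
  N = n G

  inL-position : ∀ i u → T (inL i u) → toℕ (φ ⟨$⟩ʳ u) < i
  inL-position i u = <ᵇ⇒< _ i

  SameOutside : ℕ → Fin N → Fin N → Set
  SameOutside i u v = ∀ w → ¬ T (inL i w) → (arc G u w ≡ arc G v w) × (arc G w u ≡ arc G w v)

  same-sound : ∀ i {u v} → T (sameNb i u v) → SameOutside i u v
  same-sound i {u} {v} h w w∉L with inL i w | All.lookup (AllP.all⁺ _ (allFin N) h) (∈-allFin w)
  ... | true  | _     = ⊥-elim (w∉L _)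
  ... | false | agree with Equivalence.to T-∧ agree
  ...   | out , inn = ==ᵇ-sound out , ==ᵇ-sound inn

  same-complete : ∀ i {u v} → SameOutside i u v → T (sameNb i u v)
  same-complete i {u} {v} h = AllP.all⁻ _ (AllP.tabulate⁺ agree)
    where
    agree : ∀ w → T (if inL i w then true
                     else ((arc G u w ==ᵇ arc G v w) ∧ (arc G w u ==ᵇ arc G w v)))
    agree w with inL i w | h w
    ... | true  | _      = _
    ... | false | same-w with same-w (λ ())
    ...   | out , inn rewrite out | inn = Equivalence.from T-∧ (==ᵇ-refl (arc G v w) , ==ᵇ-refl (arc G w v))

  same-refl : ∀ i u → T (sameNb i u u)
  same-refl i u = same-complete i λ _ _ → refl , refl

  same-sym : ∀ i {u v} → T (sameNb i u v) → T (sameNb i v u)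
  same-sym i h = same-complete i λ w w∉L → let out , inn = same-sound i h w w∉L in sym out , sym inn

  same-trans : ∀ i {u v x} → T (sameNb i u v) → T (sameNb i v x) → T (sameNb i u x)
  same-trans i h h′ = same-complete i λ w w∉L →
    let out , inn = same-sound i h w w∉L ; out′ , inn′ = same-sound i h′ w w∉L
    in trans out out′ , trans inn inn′

  -- Moving the cut right shrinks R(i), so equivalent vertices stay equivalent.
  same-next : ∀ i {u v} → T (sameNb i u v) → T (sameNb (suc i) u v)
  same-next i h = same-complete (suc i) λ w w∉L′ → same-sound i h w λ w∈L →
    w∉L′ (<⇒<ᵇ (m≤n⇒m≤1+n (inL-position i w w∈L)))

  isRep : ℕ → Fin N → Bool
  isRep i u = inL i u ∧ not (any (λ v → inL i v ∧ (toℕ v <ᵇ toℕ u) ∧ sameNb i v u) (allFin N))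

  reps : ℕ → List (Fin N)
  reps i = filterᵇ (isRep i) (allFin N)

  length-reps : ∀ i → length (reps i) ≡ numNb i
  length-reps i = sym (count≡length-filter (isRep i) (allFin N))

  reps-are-reps : ∀ i → All (T ∘ isRep i) (reps i)
  reps-are-reps i = AllP.all-filter (T? ∘ isRep i) (allFin N)

  reps-distinct : ∀ i → AllPairs _≢_ (reps i)
  reps-distinct i = AllPairsP.filter⁺ (T? ∘ isRep i) (allFin⁺ N)

  rep-in-L : ∀ i {r} → T (isRep i r) → T (inL i r)
  rep-in-L i r-rep = proj₁ (Equivalence.to T-∧ r-rep)

  rep-first : ∀ i {u v} → T (isRep i u) → T (inL i v) → toℕ v < toℕ u → ¬ T (sameNb i v u)
  rep-first i {u} {v} u-rep v∈L v<u v~u =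
    not-T (proj₂ (Equivalence.to T-∧ u-rep))
          (AnyP.any⁺ _ (AnyP.tabulate⁺ v
                    (Equivalence.from T-∧ (v∈L , Equivalence.from T-∧ (<⇒<ᵇ v<u , v~u)))))
    where
    not-T : ∀ {b} → T (not b) → ¬ T b
    not-T {false} _ ()

  reps-inequivalent : ∀ i {r r′} → T (isRep i r) → T (isRep i r′) → r ≢ r′ → ¬ T (sameNb i r r′)
  reps-inequivalent i {r} {r′} r-rep r′-rep r≢r′ r~r′ with <-cmp (toℕ r) (toℕ r′)
  ... | tri< r<r′ _ _ = rep-first i r′-rep (rep-in-L i r-rep) r<r′ r~r′
  ... | tri≈ _ r≡r′ _ = r≢r′ (toℕ-injective r≡r′)
  ... | tri> _ _ r′<r = rep-first i r-rep (rep-in-L i r′-rep) r′<r (same-sym i r~r′)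

  -- Every vertex of L(i) is equivalent to a representative (the earliest
  -- vertex of its class); by well-founded recursion on the position in Fin N.
  rep-exists : ∀ i {u} → T (inL i u) → ∃ λ r → T (isRep i r) × T (sameNb i r u)
  rep-exists i {u} u∈L = go u (<-wellFounded (toℕ u)) u∈L
    where
    earlier : ∀ {a b} → T a → (a ∧ not b) ≡ false → T b
    earlier {true} {true} _ _ = _
    go : ∀ u → Acc _<_ (toℕ u) → T (inL i u) → ∃ λ r → T (isRep i r) × T (sameNb i r u)
    go u (acc smaller) u∈L with isRep i u in u-rep
    ... | true  = u , subst T (sym u-rep) _ , same-refl i u
    ... | false with AnyP.tabulate⁻ (AnyP.any⁻ _ (allFin N) (earlier u∈L u-rep))
    ...   | v , v∈L∧v<u∧v~u with Equivalence.to T-∧ v∈L∧v<u∧v~u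
    ...     | v∈L , v<u∧v~u with Equivalence.to T-∧ v<u∧v~u
    ...       | v<u , v~u with go v (smaller (<ᵇ⇒< _ _ v<u)) v∈L
    ...         | r , r-rep , r~v = r , r-rep , same-trans i r~v v~u

  -- If vertices of L(i) with equal f-values are equivalent, there are at most k
  -- classes, since f is then injective on the representatives.
  numNb≤ : ∀ {k} i (f : Fin N → Fin k) →
           (∀ x y → T (inL i x) → T (inL i y) → f x ≡ f y → T (sameNb i x y)) → numNb i ≤ k
  numNb≤ {k} i f f-classes =
    subst (_≤ k) (trans (length-map f (reps i)) (length-reps i))
      (distinct-length (AllPairsP.map⁺ (allPairs-with (reps-are-reps i) (reps-distinct i) f-injective)))
    where
    f-injective : ∀ {r r′} → T (isRep i r) → T (isRep i r′) → r ≢ r′ → f r ≢ f r′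
    f-injective r-rep r′-rep r≢r′ fr≡fr′ =
      reps-inequivalent i r-rep r′-rep r≢r′ (f-classes _ _ (rep-in-L i r-rep) (rep-in-L i r′-rep) fr≡fr′)

  -- The class of x ∈ L(i), coded by the position of its representative in reps i.
  code : ℕ → Fin N → ℕ
  code i x = firstIndex (λ r → sameNb i r x) (reps i)

  class-listed : ∀ i {x} → T (inL i x) → T (any (λ r → sameNb i r x) (reps i))
  class-listed i x∈L with rep-exists i x∈L
  ... | r , r-rep , r~x =
    AnyP.any⁺ _ (Any.map (λ { refl → r~x }) (∈-filter⁺ (T? ∘ isRep i) (∈-allFin r) r-rep))

  code-< : ∀ i {x} → T (inL i x) → code i x < numNb i
  code-< i {x} x∈L = subst (code i x <_) (length-reps i) (firstIndex-< _ (reps i) (class-listed i x∈L))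

  code-cong : ∀ i {x y} → T (sameNb i x y) → code i x ≡ code i y
  code-cong i x~y = firstIndex-cong (λ r → T-ext (λ r~x → same-trans i r~x x~y)
                                                 (λ r~y → same-trans i r~y (same-sym i x~y))) (reps i)

-- In ⟦ e ⟧ⁿ the vertex 0 is the last one inserted; after the first i insertions
-- the inserted ("old") vertices are those with M ≤ i + t, the rest is "new".
Old New : ∀ {k} (e : NLCExpr k) → ℕ → Fin (m ⟦ e ⟧ⁿ) → Set
Old e i t = m ⟦ e ⟧ⁿ ≤ i + toℕ t
New e i t = i + toℕ t < m ⟦ e ⟧ⁿ

-- The state of a linear NLC expression at a cut: old vertices carry some labels
-- there, afterwards their labels only evolve by a relabelling, and old vertices
-- with equal labels are treated alike by every new vertex.
record Cut {k} (e : NLCExpr k) (i : ℕ) : Set where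
  field
    label       : Fin (m ⟦ e ⟧ⁿ) → Fin k
    later       : Fin k → Fin k
    label-later : ∀ u → Old e i u → lab ⟦ e ⟧ⁿ u ≡ later (label u)
    twins       : ∀ u v → Old e i u → Old e i v → label u ≡ label v →
                  ∀ w → New e i w → (larc ⟦ e ⟧ⁿ u w ≡ larc ⟦ e ⟧ⁿ v w) × (larc ⟦ e ⟧ⁿ w u ≡ larc ⟦ e ⟧ⁿ w v)

-- When the cut lies beyond the
-- vertices of e there are no new vertices; otherwise an insertion adds a new
-- vertex whose arcs to old vertices depend only on their labels.
cut : ∀ {k} (e : NLCExpr k) i → Cut e i
cut (• a) i = record { label = λ _ → a ; later = λ c → c ; label-later = λ _ _ → refl
                     ; twins = λ _ _ _ _ _ _ _ → refl , refl }
cut (relab R e) i = record { label = label ; later = R ∘ later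
                           ; label-later = λ u old → cong R (label-later u old) ; twins = twins }
  where open Cut (cut e i)
cut (e ⊗[ S→ , S← ]• a) i with i ≤? m ⟦ e ⟧ⁿ
... | no  i≰M = record { label = lab ⟦ e ⊗[ S→ , S← ]• a ⟧ⁿ ; later = λ c → c ; label-later = λ _ _ → refl
                       ; twins = λ _ _ _ _ _ w new → ⊥-elim (i≰M (≤-pred (≤-trans (s≤s (m≤m+n i (toℕ w))) new))) }
... | yes i≤M = record { label = label′ ; later = later ; label-later = label-later′ ; twins = twins′ }
  where
  open Cut (cut e i)
  M = m ⟦ e ⟧ⁿ
  label′ : Fin (suc M) → Fin _
  label′ zero    = a
  label′ (suc u) = label u
  not-old-0 : ¬ (suc M ≤ i + 0)
  not-old-0 old = ≤⇒≯ i≤M (subst (suc M ≤_) (+-identityʳ i) old)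
  old-suc : ∀ u → suc M ≤ i + toℕ (suc {M} u) → Old e i u
  old-suc u old = ≤-pred (subst (suc M ≤_) (+-suc i (toℕ u)) old)
  new-suc : ∀ w → i + toℕ (suc {M} w) < suc M → New e i w
  new-suc w new = ≤-pred (subst (_< suc M) (+-suc i (toℕ w)) new)
  label-later′ : ∀ u → suc M ≤ i + toℕ u → _
  label-later′ zero    old = ⊥-elim (not-old-0 old)
  label-later′ (suc u) old = label-later u (old-suc u old)
  twins′ : ∀ u v → _
  twins′ zero    _       old _   _ _ _ = ⊥-elim (not-old-0 old)
  twins′ (suc u) zero    _   old _ _ _ = ⊥-elim (not-old-0 old)
  twins′ (suc u) (suc v) old-u old-v same zero _
    rewrite label-later u (old-suc u old-u) | label-later v (old-suc v old-v) | same = refl , refl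
  twins′ (suc u) (suc v) old-u old-v same (suc w) new =
    twins u v (old-suc u old-u) (old-suc v old-v) same w (new-suc w new)

-- Position arithmetic for the reversed insertion order: position M - 1 - t is
-- left of the cut i exactly when t is old.
before-cut : ∀ {M t i} → t < M → M ∸ suc t < i → M ≤ i + t
before-cut {M} {t} {i} t<M p<i = begin
  M                 ≡⟨ sym (m∸n+n≡m t<M) ⟩
  M ∸ suc t + suc t ≡⟨ +-suc (M ∸ suc t) t ⟩
  suc (M ∸ suc t) + t ≤⟨ +-monoˡ-≤ t p<i ⟩
  i + t             ∎
  where open ≤-Reasoning

after-cut : ∀ {M t i} → t < M → ¬ (M ∸ suc t < i) → i + t < M
after-cut {M} {t} {i} t<M p≮i = begin-strict
  i + t             <⟨ +-monoʳ-< i (n<1+n t) ⟩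
  i + suc t         ≤⟨ +-monoˡ-≤ (suc t) (≮⇒≥ p≮i) ⟩
  M ∸ suc t + suc t ≡⟨ m∸n+n≡m t<M ⟩
  M                 ∎
  where open ≤-Reasoning

-- A linear NLC expression with k labels yields a layout of neighbourhood width at
-- most k: lay the vertices out in insertion order; at each cut, old vertices with
-- the same label have the same neighbours among the later ones.
lnlcw⇒nw : ∀ {G k} → HasLnlcw G k → Σ (Permutation′ (n G)) λ φ → NW.width G φ ≤ k
lnlcw⇒nw {G} {k} (e , τ , iso) = φ , max-least numNb (upTo (suc N)) classes≤k
  where
  M = m ⟦ e ⟧ⁿ
  φ : Permutation′ (n G)
  φ = flip τ ∘ₚ (reverse ∘ₚ cast-id (↔⇒≡ τ))
  open Neighbourhoods G φ
  t : Fin N → ℕ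
  t x = toℕ (τ ⟨$⟩ˡ x)
  position : ∀ x → toℕ (φ ⟨$⟩ʳ x) ≡ M ∸ suc (t x)
  position x = trans (toℕ-cast (↔⇒≡ τ) (opposite (τ ⟨$⟩ˡ x))) (opposite-prop (τ ⟨$⟩ˡ x))
  arc≡ : ∀ x y → arc G x y ≡ larc ⟦ e ⟧ⁿ (τ ⟨$⟩ˡ x) (τ ⟨$⟩ˡ y)
  arc≡ x y = trans (cong₂ (arc G) (sym (inverseʳ τ)) (sym (inverseʳ τ))) (sym (iso _ _))
  classes≤k : ∀ i → numNb i ≤ k
  classes≤k i = numNb≤ i (label ∘ (τ ⟨$⟩ˡ_)) same-label⇒same
    where
    open Cut (cut e i)
    old : ∀ x → T (inL i x) → Old e i (τ ⟨$⟩ˡ x)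
    old x x∈L = before-cut (toℕ<n _) (subst (_< i) (position x) (inL-position i x x∈L))
    new : ∀ w → ¬ T (inL i w) → New e i (τ ⟨$⟩ˡ w)
    new w w∉L = after-cut (toℕ<n _) λ p<i → w∉L (<⇒<ᵇ (subst (_< i) (sym (position w)) p<i))
    same-label⇒same : ∀ x y → T (inL i x) → T (inL i y) → label (τ ⟨$⟩ˡ x) ≡ label (τ ⟨$⟩ˡ y) →
                      T (sameNb i x y)
    same-label⇒same x y x∈L y∈L same = same-complete i λ w w∉L →
      let out , inn = twins _ _ (old x x∈L) (old y y∈L) same _ (new w w∉L)
      in trans (arc≡ x w) (trans out (sym (arc≡ y w))) , trans (arc≡ w x) (trans inn (sym (arc≡ w y)))

-- After inserting the vertex
-- at position j, every inserted vertex is labelled by (the code of) its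
-- neighbourhood class at cut j + 1; the extra label "fresh" marks the vertex being
-- inserted.  Its arcs to earlier vertices are decided by a member of their class,
-- which has the same neighbours outside the cut.
module FromLayout (G : Digraph) (φ : Permutation′ (n G)) (d : Fin (n G)) where
  open Neighbourhoods G φ

  W : ℕ
  W = width

  vertexAt : ℕ → Fin N
  vertexAt p = φ ⟨$⟩ˡ clamp d p

  position-vertexAt : ∀ {p} → p < N → toℕ (φ ⟨$⟩ʳ vertexAt p) ≡ p
  position-vertexAt p<N = trans (cong toℕ (inverseʳ φ)) (toℕ-clamp d p<N)

  vertexAt-inL : ∀ {p i} → p < N → p < i → T (inL i (vertexAt p))
  vertexAt-inL {p} {i} p<N p<i = <⇒<ᵇ (subst (_< i) (sym (position-vertexAt p<N)) p<i)

  vertexAt-notInL : ∀ {p} → p < N → ¬ T (inL p (vertexAt p))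
  vertexAt-notInL {p} p<N p∈L = <-irrefl (position-vertexAt p<N) (inL-position p _ p∈L)

  classes≤W : ∀ {i} → i ≤ N → numNb i ≤ W
  classes≤W i≤N = max-upper numNb (∈-upTo⁺ (s≤s i≤N))

  fresh : Fin (suc W)
  fresh = fromℕ W

  classLabel : ℕ → Fin N → Fin (suc W)
  classLabel i x = clamp fresh (code i x)

  member : ℕ → Fin (suc W) → Fin N
  member p c = if toℕ c <ᵇ W then entry d (reps p) (toℕ c) else vertexAt p

  member-fresh : ∀ p → member p fresh ≡ vertexAt p
  member-fresh p rewrite toℕ-fromℕ W | <ᵇ-irrefl W = refl

  code<W : ∀ {p x} → p ≤ N → T (inL p x) → code p x < W
  code<W {p} p≤N x∈L = <-≤-trans (code-< p x∈L) (classes≤W p≤N)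

  member-class : ∀ {p x} → p ≤ N → T (inL p x) → T (sameNb p (member p (classLabel p x)) x)
  member-class {p} {x} p≤N x∈L rewrite toℕ-clamp fresh (≤-trans (code<W p≤N x∈L) (n≤1+n W))
                                     | Equivalence.to T-≡ (<⇒<ᵇ (code<W p≤N x∈L))
    = firstIndex-entry d _ (reps p) (class-listed p x∈L)

  next : ℕ → Fin (suc W) → Fin (suc W)
  next p c = classLabel (suc p) (member p c)

  toNew fromNew : ℕ → Fin (suc W) → Fin (suc W) → Bool
  toNew   p c _ = arc G (member p c) (vertexAt p)
  fromNew p c _ = arc G (vertexAt p) (member p c)

  prefix : ℕ → NLCExpr (suc W)
  prefix zero    = relab (next 0) (• fresh)
  prefix (suc j) = relab (next (suc j)) (prefix j ⊗[ toNew (suc j) , fromNew (suc j) ]• fresh)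

  size-prefix : ∀ j → m ⟦ prefix j ⟧ⁿ ≡ suc j
  size-prefix zero    = refl
  size-prefix (suc j) = cong suc (size-prefix j)

  -- vertex t of prefix j (t = 0 is the last inserted) is the vertex at position j - t
  vertexOf : ∀ j → Fin (m ⟦ prefix j ⟧ⁿ) → Fin N
  vertexOf j t = vertexAt (j ∸ toℕ t)

  record Represents (j : ℕ) : Set where
    field
      arcs : ∀ t u → larc ⟦ prefix j ⟧ⁿ t u ≡ arc G (vertexOf j t) (vertexOf j u)
      labs : ∀ t → lab ⟦ prefix j ⟧ⁿ t ≡ classLabel (suc j) (vertexOf j t)

  represents : ∀ j → j < N → Represents j
  represents zero _ = record { arcs = λ { zero zero → sym (loopless G _) }
                             ; labs = λ { zero → cong (classLabel 1) (member-fresh 0) } }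
  represents (suc j) p<N = record { arcs = arcs′ ; labs = labs′ }
    where
    open Represents (represents j (<-trans (n<1+n j) p<N))
    p = suc j
    H = ⟦ prefix j ⟧ⁿ
    old∈L : ∀ t → T (inL p (vertexOf j t))
    old∈L t = vertexAt-inL (≤-<-trans (m∸n≤m j (toℕ t)) (<-trans (n<1+n j) p<N))
                           (s≤s (m∸n≤m j (toℕ t)))
    represented : ∀ t → T (sameNb p (member p (lab H t)) (vertexOf j t))
    represented t rewrite labs t = member-class (<⇒≤ p<N) (old∈L t)
    arcs′ : ∀ t u → _
    arcs′ zero    zero    = sym (loopless G (vertexAt p))
    arcs′ (suc t) zero    = proj₁ (same-sound p (represented t) (vertexAt p) (vertexAt-notInL p<N))
    arcs′ zero    (suc t) = proj₂ (same-sound p (represented t) (vertexAt p) (vertexAt-notInL p<N))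
    arcs′ (suc t) (suc u) = arcs t u
    labs′ : ∀ t → _
    labs′ zero    = cong (classLabel (suc p)) (member-fresh p)
    labs′ (suc t) = cong (clamp fresh) (code-cong (suc p) (same-next p (represented t)))

  -- the last position; N ≥ 1 since d is a vertex
  J : ℕ
  J = N ∸ 1

  suc-J : suc J ≡ N
  suc-J = m+[n∸m]≡n (≤-trans (s≤s z≤n) (toℕ<n d))

  nw⇒lnlcw : HasLnlcw G (suc W)
  nw⇒lnlcw = prefix J , π , λ t u →
    trans (arcs t u) (sym (cong₂ (arc G) (π-vertexOf t) (π-vertexOf u)))
    where
    open Represents (represents J (subst (J <_) suc-J (n<1+n J)))
    size≡N : m ⟦ prefix J ⟧ⁿ ≡ N
    size≡N = trans (size-prefix J) suc-J
    -- reading prefix J backwards is the layout φ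
    π : Permutation (m ⟦ prefix J ⟧ⁿ) N
    π = cast-id size≡N ∘ₚ (reverse ∘ₚ flip φ)
    π-vertexOf : ∀ t → π ⟨$⟩ʳ t ≡ vertexOf J t
    π-vertexOf t = sym (trans (cong vertexAt (sym position)) (cong (φ ⟨$⟩ˡ_) (clamp-toℕ d _)))
      where
      position : toℕ (opposite (cast size≡N t)) ≡ J ∸ toℕ t
      position = trans (opposite-prop (cast size≡N t))
                       (cong₂ _∸_ (sym suc-J) (cong suc (toℕ-cast size≡N t)))

Has : Param → Digraph → ℕ → Set
Has d-nw    G k = Σ (Permutation′ (n G)) λ φ → NW.width G φ ≤ k
Has d-lnlcw G k = HasLnlcw G k
Has d-lcw   G k = HasLcw G k

witness : ∀ p {G x} → IsParam p G x → Has p G x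
witness d-nw    ((φ , width≡x) , _) = φ , ≤-reflexive width≡x
witness d-lnlcw (has , _)           = has
witness d-lcw   (has , _)           = has

minimal : ∀ p {G x k} → IsParam p G x → Has p G k → x ≤ k
minimal d-nw    (_ , least) (φ , width≤k) = ≤-trans (least φ) width≤k
minimal d-lnlcw (_ , least) has          = least _ has
minimal d-lcw   (_ , least) has          = least _ has

toNw : ∀ q {G k} → Has q G k → Has d-nw G k
toNw d-nw        has = has
toNw d-lnlcw {G} has = lnlcw⇒nw {G} has
toNw d-lcw   {G} has = lnlcw⇒nw {G} (lcw⇒lnlcw {G} has)

-- Expressions always build at least one vertex, so only digraphs with a vertex
-- have a linear NLC- or clique-width; a layout exists for every digraph.
Inhabited : Param → Digraph → Set
Inhabited d-nw    _ = ⊤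
Inhabited d-lnlcw G = Fin (n G)
Inhabited d-lcw   G = Fin (n G)

some-vertex : ∀ {k} (e : NLCExpr k) → Fin (m ⟦ e ⟧ⁿ)
some-vertex (• _)             = zero
some-vertex (_ ⊗[ _ , _ ]• _) = zero
some-vertex (relab _ e)       = some-vertex e

inhabited : ∀ p {G x} → IsParam p G x → Inhabited p G
inhabited d-nw        _                 = tt
inhabited d-lnlcw     ((e , τ , _) , _) = τ ⟨$⟩ʳ some-vertex e
inhabited d-lcw   {G} (has , _) with lcw⇒lnlcw {G} has
... | e , τ , _ = τ ⟨$⟩ʳ some-vertex e

slope intercept : Param → ℕ
slope d-nw    = 1
slope d-lnlcw = 1
slope d-lcw   = 2
intercept d-nw    = 0
intercept d-lnlcw = 1
intercept d-lcw   = 2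

fromNw : ∀ p {G} → Inhabited p G → (φ : Permutation′ (n G)) →
         Has p G (lin (slope p) (intercept p) (NW.width G φ))
fromNw d-nw    _ φ = φ , ≤-reflexive (sym (lin-1-0 _))
  where
  lin-1-0 : ∀ w → 1 * w + 0 ≡ w
  lin-1-0 = solve-∀
fromNw d-lnlcw {G} v φ = subst (HasLnlcw G) (sym (lin-1-1 _)) (FromLayout.nw⇒lnlcw G φ v)
  where
  lin-1-1 : ∀ w → 1 * w + 1 ≡ suc w
  lin-1-1 = solve-∀
fromNw d-lcw   {G} v φ = subst (HasLcw G) (sym (lin-2-2 _)) (lnlcw⇒lcw {G} (FromLayout.nw⇒lnlcw G φ v))
  where
  lin-2-2 : ∀ w → 2 * w + 2 ≡ suc w + suc w
  lin-2-2 = solve-∀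

lin-mono : ∀ a b {x y} → x ≤ y → lin a b x ≤ lin a b y
lin-mono a b x≤y = +-monoˡ-≤ b (*-monoʳ-≤ a x≤y)

-- p(G) ≤ slope p · q(G) + intercept p, by passing through neighbourhood width.
bound : ∀ p q {G x y} → IsParam p G x → IsParam q G y → x ≤ lin (slope p) (intercept p) y
bound p q {G} px qy with toNw q {G} (witness q {G} qy)
... | φ , width≤y = ≤-trans (minimal p {G} px (fromNw p (inhabited p {G} px) φ))
                            (lin-mono (slope p) (intercept p) width≤y)

theorem5p6 : (p q : Param) →
    Σ ℕ λ a₁ → Σ ℕ λ b₁ → Σ ℕ λ a₂ → Σ ℕ λ b₂ →
    ∀ (G : Digraph) (x y : ℕ) → IsParam p G x → IsParam q G y →
    (x ≤ lin a₁ b₁ y) × (y ≤ lin a₂ b₂ x)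
theorem5p6 p q = slope p , intercept p , slope q , intercept q ,
                 λ G x y px qy → bound p q px qy , bound q p qy px
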